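{- For every $n\in\mathbb{N}$, $(AB)^nA - B(AB)^n = P_{2n+1}\begin{pmatrix}-1&0\\0&1\end{pmatrix}$, where $A=\begin{pmatrix}1&1\\1&2\end{pmatrix}$, $B=\begin{pmatrix}2&1\\1&1\end{pmatrix}$ and $P_k$ is the $k$-th Pell number.
   Context: Pell numbers: $P_0=0$, $P_1=1$, $P_{k+2}=2P_{k+1}+P_k$. -}

module Defs where

open import Data.Nat using (ℕ; zero; suc)
open import Data.Integer using (ℤ; +_; -_; _+_; _*_; _-_)

pell : ℕ → ℕ
pell zero = zero
pell (suc zero) = suc zero
pell (suc (suc k)) = 2 Data.Nat.* pell (suc k) Data.Nat.+ pell k

record M2 : Set where
  constructor mat
  field
    a11 a12 a21 a22 : ℤ
open M2 public

_⊗_ : M2 → M2 → M2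
mat a b c d ⊗ mat e f g h = mat (a * e + b * g) (a * f + b * h) (c * e + d * g) (c * f + d * h)

_⊖_ : M2 → M2 → M2
mat a b c d ⊖ mat e f g h = mat (a - e) (b - f) (c - g) (d - h)

_·_ : ℤ → M2 → M2
k · mat a b c d = mat (k * a) (k * b) (k * c) (k * d)

I₂ : M2
I₂ = mat (+ 1) (+ 0) (+ 0) (+ 1)

_^_ : M2 → ℕ → M2
M ^ zero = I₂
M ^ suc n = M ⊗ (M ^ n)

A B J : M2
A = mat (+ 1) (+ 1) (+ 1) (+ 2)
B = mat (+ 2) (+ 1) (+ 1) (+ 1)
J = mat (- (+ 1)) (+ 0) (+ 0) (+ 1)

-- AB = [[3,2],[4,3]] preserves the family [[b − a, a], [2a, b − a]], acting on (a, b) as two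
-- steps of the Pell recurrence (a, b) ↦ (b, 2b + a). Hence (AB)ⁿ is the member with
-- (a, b) = (P₂ₙ, P₂ₙ₊₁), and every member M of the family satisfies M A − B M = b J.
module Submission where

open import Defs
open import Data.Nat using (ℕ; suc)
import Data.Nat as ℕ
open import Data.Nat.Properties using (*-distribˡ-+)
open import Data.Integer using (ℤ; +_; -_; _+_; _*_; _-_)
open import Data.Integer.Properties using (pos-+; pos-*)
open import Data.Integer.Tactic.RingSolver using (solve-∀)
open import Relation.Binary.PropositionalEquality using (_≡_; refl; sym; trans; cong; cong₂; module ≡-Reasoning)

mat-cong : ∀ {a b c d e f g h} → a ≡ e → b ≡ f → c ≡ g → d ≡ h → mat a b c d ≡ mat e f g h
mat-cong refl refl refl refl = refl

pellMatrix : ℤ → ℤ → M2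
pellMatrix a b = mat (b - a) a (+ 2 * a) (b - a)

pell-recurrenceᶻ : ∀ k → + pell (suc (suc k)) ≡ + 2 * + pell (suc k) + + pell k
pell-recurrenceᶻ k =
  trans (pos-+ (2 ℕ.* pell (suc k)) (pell k)) (cong (_+ + pell k) (pos-* 2 (pell (suc k))))

AB⊗pellMatrix : ∀ a b → (A ⊗ B) ⊗ pellMatrix a b ≡ pellMatrix (+ 2 * b + a) (+ 2 * (+ 2 * b + a) + b)
AB⊗pellMatrix a b = mat-cong (e₁₁ a b) (e₁₂ a b) (e₂₁ a b) (e₂₂ a b)
  where
  e₁₁ : ∀ a b → + 3 * (b - a) + + 2 * (+ 2 * a) ≡ (+ 2 * (+ 2 * b + a) + b) - (+ 2 * b + a)
  e₁₁ = solve-∀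
  e₁₂ : ∀ a b → + 3 * a + + 2 * (b - a) ≡ + 2 * b + a
  e₁₂ = solve-∀
  e₂₁ : ∀ a b → + 4 * (b - a) + + 3 * (+ 2 * a) ≡ + 2 * (+ 2 * b + a)
  e₂₁ = solve-∀
  e₂₂ : ∀ a b → + 4 * a + + 3 * (b - a) ≡ (+ 2 * (+ 2 * b + a) + b) - (+ 2 * b + a)
  e₂₂ = solve-∀

AB⊗pellMatrix-pell : ∀ k →
  (A ⊗ B) ⊗ pellMatrix (+ pell k) (+ pell (suc k)) ≡ pellMatrix (+ pell (2 ℕ.+ k)) (+ pell (3 ℕ.+ k))
AB⊗pellMatrix-pell k = begin
  (A ⊗ B) ⊗ pellMatrix (+ pell k) (+ pell (suc k))
    ≡⟨ AB⊗pellMatrix (+ pell k) (+ pell (suc k)) ⟩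
  pellMatrix (+ 2 * + pell (suc k) + + pell k) (+ 2 * (+ 2 * + pell (suc k) + + pell k) + + pell (suc k))
    ≡⟨ cong₂ pellMatrix (sym (pell-recurrenceᶻ k)) (sym pell₃) ⟩
  pellMatrix (+ pell (2 ℕ.+ k)) (+ pell (3 ℕ.+ k)) ∎
  where
  open ≡-Reasoning
  pell₃ : + pell (3 ℕ.+ k) ≡ + 2 * (+ 2 * + pell (suc k) + + pell k) + + pell (suc k)
  pell₃ = trans (pell-recurrenceᶻ (suc k)) (cong (λ x → + 2 * x + + pell (suc k)) (pell-recurrenceᶻ k))

AB^n≡pellMatrix : ∀ n → (A ⊗ B) ^ n ≡ pellMatrix (+ pell (2 ℕ.* n)) (+ pell (suc (2 ℕ.* n)))
AB^n≡pellMatrix ℕ.zero = refl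
AB^n≡pellMatrix (suc n) = begin
  (A ⊗ B) ⊗ ((A ⊗ B) ^ n)
    ≡⟨ cong ((A ⊗ B) ⊗_) (AB^n≡pellMatrix n) ⟩
  (A ⊗ B) ⊗ pellMatrix (+ pell (2 ℕ.* n)) (+ pell (suc (2 ℕ.* n)))
    ≡⟨ AB⊗pellMatrix-pell (2 ℕ.* n) ⟩
  pellMatrix (+ pell (2 ℕ.+ 2 ℕ.* n)) (+ pell (3 ℕ.+ 2 ℕ.* n))
    ≡⟨ cong (λ k → pellMatrix (+ pell k) (+ pell (suc k))) (sym (*-distribˡ-+ 2 1 n)) ⟩
  pellMatrix (+ pell (2 ℕ.* suc n)) (+ pell (suc (2 ℕ.* suc n))) ∎
  where open ≡-Reasoning

pellMatrix-commutator : ∀ a b → (pellMatrix a b ⊗ A) ⊖ (B ⊗ pellMatrix a b) ≡ b · J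
pellMatrix-commutator a b = mat-cong (e₁₁ a b) (e₁₂ a b) (e₂₁ a b) (e₂₂ a b)
  where
  e₁₁ : ∀ a b → (b - a) * + 1 + a * + 1 - (+ 2 * (b - a) + + 1 * (+ 2 * a)) ≡ b * - (+ 1)
  e₁₁ = solve-∀
  e₁₂ : ∀ a b → (b - a) * + 1 + a * + 2 - (+ 2 * a + + 1 * (b - a)) ≡ b * + 0
  e₁₂ = solve-∀
  e₂₁ : ∀ a b → + 2 * a * + 1 + (b - a) * + 1 - (+ 1 * (b - a) + + 1 * (+ 2 * a)) ≡ b * + 0
  e₂₁ = solve-∀
  e₂₂ : ∀ a b → + 2 * a * + 1 + (b - a) * + 2 - (+ 1 * a + + 1 * (b - a)) ≡ b * + 1
  e₂₂ = solve-∀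

claim3p7 : (n : ℕ) →
    (((A ⊗ B) ^ n) ⊗ A) ⊖ (B ⊗ ((A ⊗ B) ^ n)) ≡ (+ pell (suc (2 Data.Nat.* n))) · J
claim3p7 n = trans (cong (λ M → (M ⊗ A) ⊖ (B ⊗ M)) (AB^n≡pellMatrix n))
                   (pellMatrix-commutator (+ pell (2 ℕ.* n)) (+ pell (suc (2 ℕ.* n))))
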